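{- For every positive integer $k$, let $\langle k\rangle$ denote the generalized pattern $k(k-1)\cdots21$ (no dashes). Then $$F_{\langle k\rangle}(x)=\sum_{j=0}^{k-1}\bigl(xF_{\langle k\rangle}(x)\bigr)^j.$$
   Context: A generalized pattern is a permutation of $\{1,\dots,k\}$ written as a word $\tau_1\cdots\tau_k$ in which each pair of adjacent letters may or may not be separated by a dash "-". A permutation $\pi=\pi_1\cdots\pi_n\in S_n$ contains $\tau$ if there are indices $i_1<\dots<i_k$ with $(\pi_{i_1},\dots,\pi_{i_k})$ order-isomorphic to $(\tau_1,\dots,\tau_k)$ and $i_{j+1}=i_j+1$ whenever $\tau_j,\tau_{j+1}$ are not separated by a dash; otherwise $\pi$ avoids $\tau$. Thus $k\cdots21$ (no dashes) requires $k$ consecutive decreasing entries, and $1\mbox{ - }3\mbox{ - }2$ is the classical pattern $132$. $F_\tau(x)=\sum_{n\geq0}f_\tau(n)x^n$, where $f_\tau(n)$ is the number of permutations in $S_n$ ($S_0$ = the empty permutation) avoiding both $1\mbox{ - }3\mbox{ - }2$ and $\tau$. -}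

module Defs where

open import Data.Nat using (ℕ; zero; suc; _+_; _*_; _∸_; _<ᵇ_; _≡ᵇ_)
open import Data.Bool using (Bool; true; false; _∧_; _∨_; not)
open import Data.List using (List; []; _∷_; length; filterᵇ; take; tails; concatMap; map)
open import Data.Bool.ListAction using (any)

-- Permutations of {1,…,n}, represented as lists π₁ ∷ … ∷ πₙ ∷ [].

insertEverywhere : ℕ → List ℕ → List (List ℕ)
insertEverywhere x []       = (x ∷ []) ∷ []
insertEverywhere x (y ∷ ys) = (x ∷ y ∷ ys) ∷ map (y ∷_) (insertEverywhere x ys)

perms : ℕ → List (List ℕ)
perms zero    = [] ∷ []
perms (suc n) = concatMap (insertEverywhere (suc n)) (perms n)

-- Containment of the classical pattern 1-3-2:
-- indices i < j < l with π_i < π_l < π_j.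

has32above : ℕ → List ℕ → Bool
has32above a []       = false
has32above a (b ∷ ys) =
  ((a <ᵇ b) ∧ any (λ c → (a <ᵇ c) ∧ (c <ᵇ b)) ys) ∨ has32above a ys

contains132 : List ℕ → Bool
contains132 []       = false
contains132 (a ∷ xs) = has32above a xs ∨ contains132 xs

-- Containment of the generalized pattern ⟨k⟩ = k(k-1)⋯21 (no dashes):
-- k consecutive entries π_i > π_{i+1} > ⋯ > π_{i+k-1}.

strictlyDecreasing : List ℕ → Bool
strictlyDecreasing []           = true
strictlyDecreasing (x ∷ [])     = true
strictlyDecreasing (x ∷ y ∷ ys) = (y <ᵇ x) ∧ strictlyDecreasing (y ∷ ys)

containsDecRun : ℕ → List ℕ → Bool
containsDecRun k π =
  any (λ t → (length (take k t) ≡ᵇ k) ∧ strictlyDecreasing (take k t)) (tails π)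

avoids132and : ℕ → List ℕ → Bool
avoids132and k π = not (contains132 π) ∧ not (containsDecRun k π)

f : ℕ → ℕ → ℕ
f k n = length (filterᵇ (avoids132and k) (perms n))

Series : Set
Series = ℕ → ℕ

F : ℕ → Series
F k = f k

sumTo : ℕ → (ℕ → ℕ) → ℕ
sumTo zero    g = g zero
sumTo (suc n) g = sumTo n g + g (suc n)

sumBelow : ℕ → (ℕ → ℕ) → ℕ
sumBelow zero    g = 0
sumBelow (suc m) g = sumBelow m g + g m

zeroS : Series
zeroS _ = 0

oneS : Series
oneS zero    = 1
oneS (suc _) = 0

_⊕_ : Series → Series → Series
(A ⊕ B) n = A n + B n

_⊗_ : Series → Series → Series
(A ⊗ B) n = sumTo n (λ i → A i * B (n ∸ i))

xTimes : Series → Series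
xTimes A zero    = 0
xTimes A (suc n) = A n

_^S_ : Series → ℕ → Series
A ^S zero  = oneS
A ^S suc j = A ⊗ (A ^S j)

sumSeries : ℕ → (ℕ → Series) → Series
sumSeries zero    A = zeroS
sumSeries (suc m) A = sumSeries m A ⊕ A m

-- A 1-3-2 avoider of length n+1 has the form α (n+1) β, where every entry of α exceeds every entry of β
-- and α, β are again 1-3-2 avoiders. Its decreasing runs are those of α, those of β, and the run
-- starting at n+1, which is n+1 followed by the initial run of β. Hence, if A_e counts the avoiders of
-- 1-3-2 and ⟨k⟩ whose initial decreasing run is shorter than e, then A_0 = 0 and, for e < k,
-- A_{e+1} = 1 + x A_e + x (A_{e+1} − 1) A_{k−1}: the term x A_e comes from α = ∅, the last one from
-- α ≠ ∅, where β must start with a run shorter than k − 1. These recurrences determine A_k = F_⟨k⟩,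
-- and the partial geometric sums Σ_{j<e} (x F_⟨k⟩)^j satisfy them.

module Submission where

open import Defs
open import Data.Nat
open import Data.Nat.Properties
open import Data.Bool using (Bool; true; false; _∧_; _∨_; not; if_then_else_)
open import Data.Bool.Properties
  using (T-≡; ∨-assoc; ∨-zeroʳ; ∨-identityʳ; ∧-zeroʳ; ∧-identityʳ; not-involutive; ∧-commutativeMonoid)
open import Data.Bool.ListAction using (any)
open import Data.List
  using (List; []; _∷_; [_]; _++_; length; map; concatMap; take; filter; filterᵇ; upTo)
open import Data.List.Properties
  using ( ++-identityʳ; ++-cancelˡ; ∷-injectiveˡ; ∷-injectiveʳ; length-map; length-++; map-∘; map-id-local
        ; concatMap-++; upTo-∷ʳ; filter-++; filter-all; filter-none)
open import Data.List.Membership.Propositional using (_∈_; _∉_; find; lose)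
open import Data.List.Membership.Propositional.Properties
open import Data.List.Membership.Propositional.Properties.WithK using (unique∧set⇒bag)
open import Data.List.Relation.Unary.Any using (here; there)
open import Data.List.Relation.Unary.All as All using (All; []; _∷_)
open import Data.List.Relation.Unary.All.Properties using () renaming (map⁺ to All-map⁺)
open import Data.List.Relation.Unary.AllPairs using ([]; _∷_)
open import Data.List.Relation.Unary.Unique.Propositional using (Unique)
import Data.List.Relation.Unary.Unique.Propositional.Properties as Unique
open import Data.List.Relation.Binary.BagAndSetEquality using (∼bag⇒↭)
open import Data.List.Relation.Binary.Permutation.Propositional
  using (_↭_; ↭-refl; ↭-prep; ↭-swap; ↭-trans; ↭-sym; ↭-reflexive; ↭⇒↭ₛ; module PermutationReasoning)
open import Data.List.Relation.Binary.Permutation.Propositional.Properties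
  using (∈-resp-↭; ↭-empty-inv; drop-mid; ↭-length; ∷↭∷ʳ; filter-↭)
  renaming (++-comm to ↭-++-comm; ++⁺ to ↭-++⁺; map⁺ to ↭-map⁺)
import Data.List.Relation.Binary.Permutation.Setoid.Properties as PermutationSetoid
open import Data.List.Extrema.Nat using (max; xs≤max; max≤v⁺; max<v⁺)
open import Data.Product using (_×_; _,_; proj₁; proj₂)
open import Data.Empty using (⊥-elim)
open import Algebra.Properties.CommutativeSemigroup +-commutativeSemigroup using (interchange)
open import Algebra.Solver.CommutativeMonoid ∧-commutativeMonoid using (solve; _⊜_) renaming (_⊕_ to _∙_)
open import Function.Base using (_∘_)
open import Function.Bundles using (mk⇔; Equivalence)
open import Relation.Nullary using (¬_; yes; no)
open import Relation.Nullary.Decidable using (T?)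
open import Relation.Unary using (Decidable; ∁)
open import Relation.Binary.PropositionalEquality hiding ([_])

-- Formal power series

sumTo-cong : ∀ n {g h : ℕ → ℕ} → (∀ i → i ≤ n → g i ≡ h i) → sumTo n g ≡ sumTo n h
sumTo-cong zero    g≗h = g≗h 0 z≤n
sumTo-cong (suc n) g≗h =
  cong₂ _+_ (sumTo-cong n (λ i i≤n → g≗h i (m≤n⇒m≤1+n i≤n))) (g≗h (suc n) ≤-refl)

sumTo-unfoldˡ : ∀ n (g : ℕ → ℕ) → sumTo (suc n) g ≡ g 0 + sumTo n (λ i → g (suc i))
sumTo-unfoldˡ zero    g = refl
sumTo-unfoldˡ (suc n) g = begin
  sumTo (suc n) g + g (suc (suc n))                 ≡⟨ cong (_+ g (suc (suc n))) (sumTo-unfoldˡ n g) ⟩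
  g 0 + sumTo n (λ i → g (suc i)) + g (suc (suc n)) ≡⟨ +-assoc (g 0) _ _ ⟩
  g 0 + sumTo (suc n) (λ i → g (suc i))             ∎
  where open ≡-Reasoning

sumTo-reverse : ∀ n (g : ℕ → ℕ) → sumTo n g ≡ sumTo n (λ i → g (n ∸ i))
sumTo-reverse zero    g = refl
sumTo-reverse (suc n) g = begin
  sumTo n g + g (suc n)                 ≡⟨ cong (_+ g (suc n)) (sumTo-reverse n g) ⟩
  sumTo n (λ i → g (n ∸ i)) + g (suc n) ≡⟨ +-comm _ (g (suc n)) ⟩
  g (suc n) + sumTo n (λ i → g (n ∸ i)) ≡⟨ sumTo-unfoldˡ n (λ i → g (suc n ∸ i)) ⟨
  sumTo (suc n) (λ i → g (suc n ∸ i))   ∎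
  where open ≡-Reasoning

sumTo-+ : ∀ n (g h : ℕ → ℕ) → sumTo n (λ i → g i + h i) ≡ sumTo n g + sumTo n h
sumTo-+ zero    g h = refl
sumTo-+ (suc n) g h = begin
  sumTo n (λ i → g i + h i) + (g (suc n) + h (suc n)) ≡⟨ cong (_+ (g (suc n) + h (suc n))) (sumTo-+ n g h) ⟩
  sumTo n g + sumTo n h + (g (suc n) + h (suc n))     ≡⟨ interchange (sumTo n g) _ _ _ ⟩
  sumTo n g + g (suc n) + (sumTo n h + h (suc n))     ∎
  where open ≡-Reasoning

*-distribˡ-sumTo : ∀ n c (g : ℕ → ℕ) → c * sumTo n g ≡ sumTo n (λ i → c * g i)
*-distribˡ-sumTo zero    c g = refl
*-distribˡ-sumTo (suc n) c g =
  trans (*-distribˡ-+ c _ _) (cong (_+ c * g (suc n)) (*-distribˡ-sumTo n c g))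

sumTo-zero : ∀ n → sumTo n (λ _ → 0) ≡ 0
sumTo-zero zero    = refl
sumTo-zero (suc n) = cong (_+ 0) (sumTo-zero n)

tailS : Series → Series
tailS A i = A (suc i)

_•_ : ℕ → Series → Series
(c • A) i = c * A i

⊗-suc : ∀ A B n → (A ⊗ B) (suc n) ≡ A 0 * B (suc n) + (tailS A ⊗ B) n
⊗-suc A B n = sumTo-unfoldˡ n (λ i → A i * B (suc n ∸ i))

⊗-cong-≤ : ∀ n {A A′ B B′ : Series} → (∀ i → i ≤ n → A i ≡ A′ i) → (∀ i → i ≤ n → B i ≡ B′ i) →
           (A ⊗ B) n ≡ (A′ ⊗ B′) n
⊗-cong-≤ n A≗A′ B≗B′ = sumTo-cong n (λ i i≤n → cong₂ _*_ (A≗A′ i i≤n) (B≗B′ (n ∸ i) (m∸n≤m n i)))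

⊗-congˡ : ∀ {A A′} B → (∀ i → A i ≡ A′ i) → ∀ n → (A ⊗ B) n ≡ (A′ ⊗ B) n
⊗-congˡ {A} {A′} B A≗A′ n = ⊗-cong-≤ n {A} {A′} {B} {B} (λ i _ → A≗A′ i) (λ _ _ → refl)

⊗-congʳ : ∀ A {B B′} → (∀ i → B i ≡ B′ i) → ∀ n → (A ⊗ B) n ≡ (A ⊗ B′) n
⊗-congʳ A {B} {B′} B≗B′ n = ⊗-cong-≤ n {A} {A} {B} {B′} (λ _ _ → refl) (λ i _ → B≗B′ i)

⊗-comm : ∀ A B n → (A ⊗ B) n ≡ (B ⊗ A) n
⊗-comm A B n = begin
  sumTo n (λ i → A i * B (n ∸ i))               ≡⟨ sumTo-reverse n _ ⟩
  sumTo n (λ i → A (n ∸ i) * B (n ∸ (n ∸ i)))   ≡⟨ sumTo-cong n swap ⟩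
  sumTo n (λ i → B i * A (n ∸ i))               ∎
  where
  open ≡-Reasoning
  swap : ∀ i → i ≤ n → A (n ∸ i) * B (n ∸ (n ∸ i)) ≡ B i * A (n ∸ i)
  swap i i≤n = trans (cong (λ j → A (n ∸ i) * B j) (m∸[m∸n]≡n i≤n)) (*-comm (A (n ∸ i)) (B i))

⊗-distribʳ : ∀ A B C n → ((A ⊕ B) ⊗ C) n ≡ (A ⊗ C) n + (B ⊗ C) n
⊗-distribʳ A B C n =
  trans (sumTo-cong n (λ i _ → *-distribʳ-+ (C (n ∸ i)) (A i) (B i))) (sumTo-+ n _ _)

⊗-distribˡ : ∀ A B C n → (A ⊗ (B ⊕ C)) n ≡ (A ⊗ B) n + (A ⊗ C) n
⊗-distribˡ A B C n =
  trans (sumTo-cong n (λ i _ → *-distribˡ-+ (A i) (B (n ∸ i)) (C (n ∸ i)))) (sumTo-+ n _ _)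

•-⊗ : ∀ c A B n → ((c • A) ⊗ B) n ≡ c * (A ⊗ B) n
•-⊗ c A B n = trans (sumTo-cong n (λ i _ → *-assoc c (A i) _)) (sym (*-distribˡ-sumTo n c _))

⊗-assoc : ∀ n A B C → ((A ⊗ B) ⊗ C) n ≡ (A ⊗ (B ⊗ C)) n
⊗-assoc zero    A B C = *-assoc (A 0) (B 0) (C 0)
⊗-assoc (suc n) A B C = begin
  ((A ⊗ B) ⊗ C) (suc n)
    ≡⟨ ⊗-suc (A ⊗ B) C n ⟩
  a₀b₀ * C (suc n) + (tailS (A ⊗ B) ⊗ C) n
    ≡⟨ cong (a₀b₀ * C (suc n) +_) (⊗-congˡ C (⊗-suc A B) n) ⟩
  a₀b₀ * C (suc n) + (((A 0 • tailS B) ⊕ (tailS A ⊗ B)) ⊗ C) n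
    ≡⟨ cong (a₀b₀ * C (suc n) +_) (⊗-distribʳ (A 0 • tailS B) (tailS A ⊗ B) C n) ⟩
  a₀b₀ * C (suc n) + (((A 0 • tailS B) ⊗ C) n + ((tailS A ⊗ B) ⊗ C) n)
    ≡⟨ cong₂ (λ u v → a₀b₀ * C (suc n) + (u + v)) (•-⊗ (A 0) (tailS B) C n) (⊗-assoc n (tailS A) B C) ⟩
  a₀b₀ * C (suc n) + (A 0 * (tailS B ⊗ C) n + (tailS A ⊗ (B ⊗ C)) n)
    ≡⟨ +-assoc (a₀b₀ * C (suc n)) _ _ ⟨
  a₀b₀ * C (suc n) + A 0 * (tailS B ⊗ C) n + (tailS A ⊗ (B ⊗ C)) n
    ≡⟨ cong (_+ (tailS A ⊗ (B ⊗ C)) n) factor-A₀ ⟩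
  A 0 * (B ⊗ C) (suc n) + (tailS A ⊗ (B ⊗ C)) n
    ≡⟨ ⊗-suc A (B ⊗ C) n ⟨
  (A ⊗ (B ⊗ C)) (suc n) ∎
  where
  open ≡-Reasoning
  a₀b₀ : ℕ
  a₀b₀ = A 0 * B 0
  factor-A₀ : a₀b₀ * C (suc n) + A 0 * (tailS B ⊗ C) n ≡ A 0 * (B ⊗ C) (suc n)
  factor-A₀ = begin
    a₀b₀ * C (suc n) + A 0 * (tailS B ⊗ C) n   ≡⟨ cong (_+ A 0 * (tailS B ⊗ C) n) (*-assoc (A 0) (B 0) _) ⟩
    A 0 * (B 0 * C (suc n)) + A 0 * (tailS B ⊗ C) n ≡⟨ *-distribˡ-+ (A 0) _ _ ⟨
    A 0 * (B 0 * C (suc n) + (tailS B ⊗ C) n)   ≡⟨ cong (A 0 *_) (⊗-suc B C n) ⟨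
    A 0 * (B ⊗ C) (suc n)                       ∎

⊗-zeroʳ : ∀ A n → (A ⊗ zeroS) n ≡ 0
⊗-zeroʳ A n = trans (sumTo-cong n (λ i _ → *-zeroʳ (A i))) (sumTo-zero n)

⊗-identityˡ : ∀ B n → (oneS ⊗ B) n ≡ B n
⊗-identityˡ B zero    = *-identityˡ (B 0)
⊗-identityˡ B (suc n) = begin
  (oneS ⊗ B) (suc n)                           ≡⟨ ⊗-suc oneS B n ⟩
  1 * B (suc n) + sumTo n (λ i → 0 * B (n ∸ i)) ≡⟨ cong₂ _+_ (*-identityˡ (B (suc n))) (sumTo-zero n) ⟩
  B (suc n) + 0                                ≡⟨ +-identityʳ _ ⟩
  B (suc n)                                    ∎
  where open ≡-Reasoning

xTimes-⊗ : ∀ A B n → (xTimes A ⊗ B) (suc n) ≡ (A ⊗ B) n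
xTimes-⊗ A B n = ⊗-suc (xTimes A) B n

positivePart : Series → Series
positivePart A zero    = 0
positivePart A (suc n) = A (suc n)

geometricSum : Series → ℕ → Series
geometricSum G e = sumSeries e (λ j → xTimes G ^S j)

geometricSum-suc : ∀ G e n → geometricSum G (suc e) n ≡ (oneS ⊕ (xTimes G ⊗ geometricSum G e)) n
geometricSum-suc G zero    n = trans (+-comm 0 (oneS n)) (cong (oneS n +_) (sym (⊗-zeroʳ (xTimes G) n)))
geometricSum-suc G (suc e) n = begin
  H (suc e) n + (xG ⊗ (xG ^S e)) n               ≡⟨ cong (_+ (xG ⊗ (xG ^S e)) n) (geometricSum-suc G e n) ⟩
  oneS n + (xG ⊗ H e) n + (xG ⊗ (xG ^S e)) n     ≡⟨ +-assoc (oneS n) _ _ ⟩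
  oneS n + ((xG ⊗ H e) n + (xG ⊗ (xG ^S e)) n)   ≡⟨ cong (oneS n +_) (⊗-distribˡ xG (H e) (xG ^S e) n) ⟨
  oneS n + (xG ⊗ H (suc e)) n                    ∎
  where
  open ≡-Reasoning
  xG : Series
  xG = xTimes G
  H : ℕ → Series
  H = geometricSum G

-- H_e = Σ_{j<e} (x G)^j satisfies the recurrence of A_e as well, because H_{e+1} = 1 + x G H_e and
-- x H_e + x (H_{e+1} − 1) H_{k−1} = x H_e (1 + x G H_{k−1}) = x H_e H_k, where H_k = A_k = G in lower
-- degrees; so A_e = H_e, by induction on the degree simultaneously for all e ≤ k.
module RecurrenceSolution
  (k′ : ℕ) (G : Series) (A : ℕ → Series)
  (A-zero     : ∀ n → A 0 n ≡ 0)
  (A-suc-zero : ∀ e → A (suc e) 0 ≡ 1)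
  (A-suc-suc  : ∀ e → e ≤ k′ → ∀ n → A (suc e) (suc n) ≡ A e n + (positivePart (A (suc e)) ⊗ A k′) n)
  (A-top      : ∀ n → A (suc k′) n ≡ G n)
  where
  open ≡-Reasoning

  private
    k : ℕ
    k = suc k′
    xG : Series
    xG = xTimes G
    H : ℕ → Series
    H = geometricSum G

    positivePart-H : ∀ e i → positivePart (H (suc e)) i ≡ (xG ⊗ H e) i
    positivePart-H e zero    = refl
    positivePart-H e (suc i) = geometricSum-suc G e (suc i)

    H-suc-suc : ∀ e n → H (suc e) (suc n) ≡ (G ⊗ H e) n
    H-suc-suc e n = trans (geometricSum-suc G e (suc n)) (xTimes-⊗ G (H e) n)

    AgreeBelow : ℕ → Set
    AgreeBelow n = ∀ m → m ≤ n → ∀ e → e ≤ k → A e m ≡ H e m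

    agree-suc : ∀ n → AgreeBelow n → ∀ e → e ≤ k → A e (suc n) ≡ H e (suc n)
    agree-suc n ih zero    _          = A-zero (suc n)
    agree-suc n ih (suc e) (s≤s e≤k′) = begin
      A (suc e) (suc n)                                ≡⟨ A-suc-suc e e≤k′ n ⟩
      A e n + (positivePart (A (suc e)) ⊗ A k′) n      ≡⟨ cong₂ _+_ (ih n ≤-refl e (m≤n⇒m≤1+n e≤k′)) positive-term ⟩
      H e n + (positivePart (H (suc e)) ⊗ H k′) n      ≡⟨ cong (H e n +_) (⊗-congˡ (H k′) (positivePart-H e) n) ⟩
      H e n + ((xG ⊗ H e) ⊗ H k′) n                    ≡⟨ cong (H e n +_) rearrange ⟩
      H e n + ((xG ⊗ H k′) ⊗ H e) n                    ≡⟨ cong (_+ ((xG ⊗ H k′) ⊗ H e) n) (⊗-identityˡ (H e) n) ⟨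
      (oneS ⊗ H e) n + ((xG ⊗ H k′) ⊗ H e) n           ≡⟨ ⊗-distribʳ oneS (xG ⊗ H k′) (H e) n ⟨
      ((oneS ⊕ (xG ⊗ H k′)) ⊗ H e) n                   ≡⟨ ⊗-cong-≤ n {B = H e} {B′ = H e} G-is-H-k (λ _ _ → refl) ⟩
      (G ⊗ H e) n                                      ≡⟨ H-suc-suc e n ⟨
      H (suc e) (suc n)                                ∎
      where
      positive-term : (positivePart (A (suc e)) ⊗ A k′) n ≡ (positivePart (H (suc e)) ⊗ H k′) n
      positive-term = ⊗-cong-≤ n {positivePart (A (suc e))} {positivePart (H (suc e))}
        (λ { zero _ → refl ; (suc i) i≤n → ih (suc i) i≤n (suc e) (s≤s e≤k′) })
        (λ i i≤n → ih i i≤n k′ (n≤1+n k′))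
      rearrange : ((xG ⊗ H e) ⊗ H k′) n ≡ ((xG ⊗ H k′) ⊗ H e) n
      rearrange = begin
        ((xG ⊗ H e) ⊗ H k′) n   ≡⟨ ⊗-assoc n xG (H e) (H k′) ⟩
        (xG ⊗ (H e ⊗ H k′)) n   ≡⟨ ⊗-congʳ xG (⊗-comm (H e) (H k′)) n ⟩
        (xG ⊗ (H k′ ⊗ H e)) n   ≡⟨ ⊗-assoc n xG (H k′) (H e) ⟨
        ((xG ⊗ H k′) ⊗ H e) n   ∎
      G-is-H-k : ∀ i → i ≤ n → (oneS ⊕ (xG ⊗ H k′)) i ≡ G i
      G-is-H-k i i≤n = begin
        (oneS ⊕ (xG ⊗ H k′)) i ≡⟨ geometricSum-suc G k′ i ⟨
        H k i                  ≡⟨ ih i i≤n k ≤-refl ⟨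
        A k i                  ≡⟨ A-top i ⟩
        G i                    ∎

    agree-zero : ∀ e → e ≤ k → A e 0 ≡ H e 0
    agree-zero zero    _ = A-zero 0
    agree-zero (suc e) _ = trans (A-suc-zero e) (sym (geometricSum-suc G e 0))

    agree : ∀ n → AgreeBelow n
    agree n       zero    _         e e≤k = agree-zero e e≤k
    agree (suc n) (suc m) (s≤s m≤n) e e≤k = agree-suc m (λ j j≤m → agree n j (≤-trans j≤m m≤n)) e e≤k

  functionalEquation : ∀ n → G n ≡ geometricSum G k n
  functionalEquation n = trans (sym (A-top n)) (agree n n ≤-refl k ≤-refl)

-- Counting in duplicate-free lists

private variable A B C : Set

countᵇ : (A → Bool) → List A → ℕ
countᵇ p xs = length (filterᵇ p xs)

countᵇ-∷ : ∀ (p : A → Bool) x xs → countᵇ p (x ∷ xs) ≡ (if p x then 1 else 0) + countᵇ p xs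
countᵇ-∷ p x xs with p x
... | true  = refl
... | false = refl

countᵇ-++ : ∀ (p : A → Bool) xs ys → countᵇ p (xs ++ ys) ≡ countᵇ p xs + countᵇ p ys
countᵇ-++ p xs ys = trans (cong length (filter-++ (T? ∘ p) xs ys)) (length-++ (filterᵇ p xs))

countᵇ-cong : ∀ {p q : A → Bool} xs → (∀ x → x ∈ xs → p x ≡ q x) → countᵇ p xs ≡ countᵇ q xs
countᵇ-cong {p = p} {q} []       p≗q = refl
countᵇ-cong {p = p} {q} (x ∷ xs) p≗q = begin
  countᵇ p (x ∷ xs)                          ≡⟨ countᵇ-∷ p x xs ⟩
  (if p x then 1 else 0) + countᵇ p xs       ≡⟨ cong₂ (λ b n → (if b then 1 else 0) + n) (p≗q x (here refl))
                                                      (countᵇ-cong xs (λ y y∈ → p≗q y (there y∈))) ⟩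
  (if q x then 1 else 0) + countᵇ q xs       ≡⟨ countᵇ-∷ q x xs ⟨
  countᵇ q (x ∷ xs)                          ∎
  where open ≡-Reasoning

countᵇ-map : ∀ (p : B → Bool) (g : A → B) xs → countᵇ p (map g xs) ≡ countᵇ (p ∘ g) xs
countᵇ-map p g []       = refl
countᵇ-map p g (x ∷ xs) = begin
  countᵇ p (g x ∷ map g xs)                      ≡⟨ countᵇ-∷ p (g x) (map g xs) ⟩
  (if p (g x) then 1 else 0) + countᵇ p (map g xs) ≡⟨ cong (_ +_) (countᵇ-map p g xs) ⟩
  (if p (g x) then 1 else 0) + countᵇ (p ∘ g) xs   ≡⟨ countᵇ-∷ (p ∘ g) x xs ⟨
  countᵇ (p ∘ g) (x ∷ xs)                        ∎
  where open ≡-Reasoning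

countᵇ-false : ∀ (xs : List A) → countᵇ (λ _ → false) xs ≡ 0
countᵇ-false []       = refl
countᵇ-false (x ∷ xs) = countᵇ-false xs

countᵇ-const-∧ : ∀ c (r : A → Bool) xs → countᵇ (λ x → c ∧ r x) xs ≡ (if c then 1 else 0) * countᵇ r xs
countᵇ-const-∧ true  r xs = sym (+-identityʳ (countᵇ r xs))
countᵇ-const-∧ false r xs = countᵇ-false xs

countᵇ-product : ∀ (p : C → Bool) (q : A → Bool) (r : B → Bool) (g : A → B → C) as bs →
  (∀ a b → a ∈ as → b ∈ bs → p (g a b) ≡ q a ∧ r b) →
  countᵇ p (concatMap (λ a → map (g a) bs) as) ≡ countᵇ q as * countᵇ r bs
countᵇ-product p q r g []       bs pg≡q∧r = refl
countᵇ-product p q r g (a ∷ as) bs pg≡q∧r = begin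
  countᵇ p (map (g a) bs ++ concatMap (λ a → map (g a) bs) as)
    ≡⟨ countᵇ-++ p (map (g a) bs) _ ⟩
  countᵇ p (map (g a) bs) + countᵇ p (concatMap (λ a → map (g a) bs) as)
    ≡⟨ cong₂ _+_ row (countᵇ-product p q r g as bs (λ a′ b a′∈ → pg≡q∧r a′ b (there a′∈))) ⟩
  (if q a then 1 else 0) * countᵇ r bs + countᵇ q as * countᵇ r bs
    ≡⟨ *-distribʳ-+ (countᵇ r bs) (if q a then 1 else 0) _ ⟨
  ((if q a then 1 else 0) + countᵇ q as) * countᵇ r bs
    ≡⟨ cong (_* countᵇ r bs) (countᵇ-∷ q a as) ⟨
  countᵇ q (a ∷ as) * countᵇ r bs ∎
  where
  open ≡-Reasoning
  row : countᵇ p (map (g a) bs) ≡ (if q a then 1 else 0) * countᵇ r bs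
  row = begin
    countᵇ p (map (g a) bs)         ≡⟨ countᵇ-map p (g a) bs ⟩
    countᵇ (p ∘ g a) bs             ≡⟨ countᵇ-cong bs (λ b b∈ → pg≡q∧r a b (here refl) b∈) ⟩
    countᵇ (λ b → q a ∧ r b) bs     ≡⟨ countᵇ-const-∧ (q a) r bs ⟩
    (if q a then 1 else 0) * countᵇ r bs ∎

countᵇ-concatMap-upTo : ∀ (p : B → Bool) (g : ℕ → List B) n →
  countᵇ p (concatMap g (upTo (suc n))) ≡ sumTo n (λ i → countᵇ p (g i))
countᵇ-concatMap-upTo p g zero    = trans (countᵇ-++ p (g 0) []) (+-identityʳ _)
countᵇ-concatMap-upTo p g (suc n) = begin
  countᵇ p (concatMap g (upTo (suc (suc n))))            ≡⟨ cong (countᵇ p ∘ concatMap g) (upTo-∷ʳ (suc n)) ⟨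
  countᵇ p (concatMap g (upTo (suc n) ++ [ suc n ]))     ≡⟨ cong (countᵇ p) (concatMap-++ g (upTo (suc n)) [ suc n ]) ⟩
  countᵇ p (concatMap g (upTo (suc n)) ++ (g (suc n) ++ []))     ≡⟨ countᵇ-++ p (concatMap g (upTo (suc n))) _ ⟩
  countᵇ p (concatMap g (upTo (suc n))) + countᵇ p (g (suc n) ++ [])
    ≡⟨ cong₂ _+_ (countᵇ-concatMap-upTo p g n) (cong (countᵇ p) (++-identityʳ (g (suc n)))) ⟩
  sumTo n (λ i → countᵇ p (g i)) + countᵇ p (g (suc n))  ∎
  where open ≡-Reasoning

∈-filterᵇ⁺ : ∀ (p : A → Bool) {x xs} → x ∈ xs → p x ≡ true → x ∈ filterᵇ p xs
∈-filterᵇ⁺ p x∈ px = ∈-filter⁺ (T? ∘ p) x∈ (Equivalence.from T-≡ px)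

∈-filterᵇ⁻ : ∀ (p : A → Bool) {x xs} → x ∈ filterᵇ p xs → x ∈ xs × p x ≡ true
∈-filterᵇ⁻ p x∈ with x∈xs , px ← ∈-filter⁻ (T? ∘ p) x∈ = x∈xs , Equivalence.to T-≡ px

countᵇ-unique : ∀ (p : A → Bool) {xs ys : List A} → Unique xs → Unique ys →
  (∀ z → p z ≡ true → z ∈ xs → z ∈ ys) → (∀ z → p z ≡ true → z ∈ ys → z ∈ xs) →
  countᵇ p xs ≡ countᵇ p ys
countᵇ-unique p uxs uys xs⊆ys ys⊆xs =
  ↭-length (∼bag⇒↭ (unique∧set⇒bag (filter-unique uxs) (filter-unique uys) (mk⇔ (transfer xs⊆ys) (transfer ys⊆xs))))
  where
  filter-unique : ∀ {us} → Unique us → Unique (filterᵇ p us)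
  filter-unique = Unique.filter⁺ (T? ∘ p)
  transfer : ∀ {us vs} → (∀ z → p z ≡ true → z ∈ us → z ∈ vs) → ∀ {z} → z ∈ filterᵇ p us → z ∈ filterᵇ p vs
  transfer us⊆vs z∈ with z∈us , pz ← ∈-filterᵇ⁻ p z∈ = ∈-filterᵇ⁺ p (us⊆vs _ pz z∈us) pz

concatMap-unique : ∀ (g : A → List B) (decode : B → A) {xs} → Unique xs →
  (∀ x → x ∈ xs → Unique (g x)) → (∀ x y → x ∈ xs → y ∈ g x → decode y ≡ x) → Unique (concatMap g xs)
concatMap-unique g decode {[]}     _          _   _       = []
concatMap-unique g decode {x ∷ xs} (x∉xs ∷ uxs) ugx decodes =
  Unique.++⁺ (ugx x (here refl))
    (concatMap-unique g decode uxs (λ x′ x′∈ → ugx x′ (there x′∈)) (λ x′ y x′∈ → decodes x′ y (there x′∈)))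
    disjoint
  where
  disjoint : ∀ {y} → ¬ (y ∈ g x × y ∈ concatMap g xs)
  disjoint {y} (y∈gx , y∈rest) with x′ , x′∈ , y∈gx′ ← find (∈-concatMap⁻ g y∈rest) =
    All.lookup x∉xs x′∈ (trans (sym (decodes x y (here refl) y∈gx)) (decodes x′ y (there x′∈) y∈gx′))

-- Permutations of [1, …, n]

unique-resp-↭ : ∀ {xs ys : List ℕ} → xs ↭ ys → Unique xs → Unique ys
unique-resp-↭ xs↭ys = PermutationSetoid.Unique-resp-↭ (setoid ℕ) (↭⇒↭ₛ xs↭ys)

interval : ℕ → ℕ → List ℕ
interval c zero    = []
interval c (suc m) = suc c ∷ interval (suc c) m

interval-bounds : ∀ c m {z} → z ∈ interval c m → c < z × z ≤ c + m
interval-bounds c (suc m) (here refl) = ≤-refl , subst (suc c ≤_) (sym (+-suc c m)) (s≤s (m≤m+n c m))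
interval-bounds c (suc m) {z} (there z∈) with c<z , z≤ ← interval-bounds (suc c) m z∈ =
  <-trans (n<1+n c) c<z , subst (z ≤_) (sym (+-suc c m)) z≤

interval-unique : ∀ c m → Unique (interval c m)
interval-unique c zero    = []
interval-unique c (suc m) =
  All.tabulate (λ z∈ c+1≡z → <-irrefl c+1≡z (proj₁ (interval-bounds (suc c) m z∈))) ∷ interval-unique (suc c) m

interval-++ : ∀ c p q → interval c (p + q) ≡ interval c p ++ interval (c + p) q
interval-++ c zero    q = cong (λ d → interval d q) (sym (+-identityʳ c))
interval-++ c (suc p) q =
  cong (suc c ∷_) (trans (interval-++ (suc c) p q) (cong (λ d → interval (suc c) p ++ interval d q) (sym (+-suc c p))))

interval-∷ʳ : ∀ n → interval 0 (suc n) ≡ interval 0 n ++ [ suc n ]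
interval-∷ʳ n = trans (cong (interval 0) (+-comm 1 n)) (interval-++ 0 n 1)

map-+-interval : ∀ c m → map (c +_) (interval 0 m) ≡ interval c m
map-+-interval c m = trans (shift 0 m) (cong (λ d → interval d m) (+-identityʳ c))
  where
  shift : ∀ d m → map (c +_) (interval d m) ≡ interval (c + d) m
  shift d zero    = refl
  shift d (suc m) = cong₂ _∷_ (+-suc c d) (trans (shift (suc d) m) (cong (λ e → interval e m) (+-suc c d)))

length-interval : ∀ c m → length (interval c m) ≡ m
length-interval c zero    = refl
length-interval c (suc m) = cong suc (length-interval (suc c) m)

insertEverywhere-↭ : ∀ x σ {π} → π ∈ insertEverywhere x σ → π ↭ x ∷ σ
insertEverywhere-↭ x []       (here refl) = ↭-refl
insertEverywhere-↭ x (y ∷ ys) (here refl) = ↭-refl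
insertEverywhere-↭ x (y ∷ ys) (there π∈) with π′ , π′∈ , refl ← ∈-map⁻ (y ∷_) π∈ =
  ↭-trans (↭-prep y (insertEverywhere-↭ x ys π′∈)) (↭-swap y x ↭-refl)

∈-insertEverywhere : ∀ x α β → α ++ x ∷ β ∈ insertEverywhere x (α ++ β)
∈-insertEverywhere x []      []      = here refl
∈-insertEverywhere x []      (b ∷ β) = here refl
∈-insertEverywhere x (a ∷ α) β       = there (∈-map⁺ (a ∷_) (∈-insertEverywhere x α β))

deleteFirst : ℕ → List ℕ → List ℕ
deleteFirst x []       = []
deleteFirst x (y ∷ ys) with y ≟ x
... | yes _ = ys
... | no  _ = y ∷ deleteFirst x ys

deleteFirst-head : ∀ x xs → deleteFirst x (x ∷ xs) ≡ xs
deleteFirst-head x xs with x ≟ x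
... | yes _   = refl
... | no  x≢x = ⊥-elim (x≢x refl)

deleteFirst-insertEverywhere : ∀ x σ {π} → x ∉ σ → π ∈ insertEverywhere x σ → deleteFirst x π ≡ σ
deleteFirst-insertEverywhere x []       _ (here refl) = deleteFirst-head x []
deleteFirst-insertEverywhere x (y ∷ ys) _ (here refl) = deleteFirst-head x (y ∷ ys)
deleteFirst-insertEverywhere x (y ∷ ys) x∉ (there π∈) with π′ , π′∈ , refl ← ∈-map⁻ (y ∷_) π∈ | y ≟ x
... | yes refl = ⊥-elim (x∉ (here refl))
... | no  _    = cong (y ∷_) (deleteFirst-insertEverywhere x ys (λ x∈ → x∉ (there x∈)) π′∈)

insertEverywhere-unique : ∀ x σ → x ∉ σ → Unique (insertEverywhere x σ)
insertEverywhere-unique x []       _   = [] ∷ []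
insertEverywhere-unique x (y ∷ ys) x∉ =
  All.tabulate head-differs ∷ Unique.map⁺ ∷-injectiveʳ (insertEverywhere-unique x ys (λ x∈ → x∉ (there x∈)))
  where
  head-differs : ∀ {π} → π ∈ map (y ∷_) (insertEverywhere x ys) → x ∷ y ∷ ys ≢ π
  head-differs π∈ x∷y∷ys≡π with _ , _ , refl ← ∈-map⁻ (y ∷_) π∈ = x∉ (here (∷-injectiveˡ x∷y∷ys≡π))

perms-↭ : ∀ n {π} → π ∈ perms n → π ↭ interval 0 n
perms-↭ zero    (here refl) = ↭-refl
perms-↭ (suc n) {π} π∈ with σ , σ∈ , π∈ins ← find (∈-concatMap⁻ (insertEverywhere (suc n)) {xs = perms n} π∈) =
  begin
  π                          ↭⟨ insertEverywhere-↭ (suc n) σ π∈ins ⟩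
  suc n ∷ σ                  ↭⟨ ↭-prep (suc n) (perms-↭ n σ∈) ⟩
  suc n ∷ interval 0 n       ↭⟨ ∷↭∷ʳ (suc n) (interval 0 n) ⟩
  interval 0 n ++ [ suc n ]  ≡⟨ interval-∷ʳ n ⟨
  interval 0 (suc n)         ∎
  where open PermutationReasoning

last∈interval : ∀ n → suc n ∈ interval 0 (suc n)
last∈interval n = subst (suc n ∈_) (sym (interval-∷ʳ n)) (∈-++⁺ʳ (interval 0 n) (here refl))

↭-perms : ∀ n {π} → π ↭ interval 0 n → π ∈ perms n
↭-perms zero    π↭ rewrite ↭-empty-inv π↭ = here refl
↭-perms (suc n) {π} π↭ with α , β , refl ← ∈-∃++ (∈-resp-↭ (↭-sym π↭) (last∈interval n)) =
  ∈-concatMap⁺ (insertEverywhere (suc n)) (lose (↭-perms n α++β↭) (∈-insertEverywhere (suc n) α β))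
  where
  α++β↭ : α ++ β ↭ interval 0 n
  α++β↭ = ↭-trans (drop-mid α (interval 0 n) (↭-trans π↭ (↭-reflexive (interval-∷ʳ n))))
                  (↭-reflexive (++-identityʳ (interval 0 n)))

perms-bounds : ∀ n {π z} → π ∈ perms n → z ∈ π → 0 < z × z ≤ n
perms-bounds n π∈ z∈ = interval-bounds 0 n (∈-resp-↭ (perms-↭ n π∈) z∈)

perms-length : ∀ n {π} → π ∈ perms n → length π ≡ n
perms-length n π∈ = trans (↭-length (perms-↭ n π∈)) (length-interval 0 n)

perms-unique : ∀ n → Unique (perms n)
perms-unique zero    = [] ∷ []
perms-unique (suc n) =
  concatMap-unique (insertEverywhere (suc n)) (deleteFirst (suc n)) (perms-unique n)
    (λ σ σ∈ → insertEverywhere-unique (suc n) σ (n+1∉ σ∈))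
    (λ σ π σ∈ π∈ → deleteFirst-insertEverywhere (suc n) σ (n+1∉ σ∈) π∈)
  where
  n+1∉ : ∀ {σ} → σ ∈ perms n → suc n ∉ σ
  n+1∉ σ∈ n+1∈ = <-irrefl refl (proj₂ (perms-bounds n σ∈ n+1∈))

-- Decreasing runs and occurrences of 1-3-2

<⇒<ᵇ≡true : ∀ {x y} → x < y → (x <ᵇ y) ≡ true
<⇒<ᵇ≡true x<y = Equivalence.to T-≡ (<⇒<ᵇ x<y)

<ᵇ≡true⇒< : ∀ {x y} → (x <ᵇ y) ≡ true → x < y
<ᵇ≡true⇒< {x} {y} eq = <ᵇ⇒< x y (Equivalence.from T-≡ eq)

≤⇒<ᵇ≡false : ∀ {x y} → y ≤ x → (x <ᵇ y) ≡ false
≤⇒<ᵇ≡false {x} {y} y≤x with x <ᵇ y in eq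
... | false = refl
... | true  = ⊥-elim (<⇒≱ (<ᵇ≡true⇒< eq) y≤x)

<ᵇ-suc : ∀ k r → (k <ᵇ suc r) ≡ not (r <ᵇ k)
<ᵇ-suc zero    r       = refl
<ᵇ-suc (suc k) zero    = refl
<ᵇ-suc (suc k) (suc r) = <ᵇ-suc k r

any-++ : ∀ (p : A → Bool) xs ys → any p (xs ++ ys) ≡ any p xs ∨ any p ys
any-++ p []       ys = refl
any-++ p (x ∷ xs) ys = trans (cong (p x ∨_) (any-++ p xs ys)) (sym (∨-assoc (p x) _ _))

any-map : ∀ (p : B → Bool) (g : A → B) xs → any p (map g xs) ≡ any (p ∘ g) xs
any-map p g []       = refl
any-map p g (x ∷ xs) = cong (p (g x) ∨_) (any-map p g xs)

any-cong : ∀ {p q : A → Bool} xs → (∀ x → p x ≡ q x) → any p xs ≡ any q xs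
any-cong []       p≗q = refl
any-cong (x ∷ xs) p≗q = cong₂ _∨_ (p≗q x) (any-cong xs p≗q)

any-false : ∀ (p : A → Bool) xs → All (λ x → p x ≡ false) xs → any p xs ≡ false
any-false p []       []          = refl
any-false p (x ∷ xs) (px ∷ pxs) rewrite px = any-false p xs pxs

any-true : ∀ (p : A → Bool) {x} xs → x ∈ xs → p x ≡ true → any p xs ≡ true
any-true p (y ∷ xs) (here refl) px rewrite px = refl
any-true p (y ∷ xs) (there x∈)  px rewrite any-true p xs x∈ px = ∨-zeroʳ (p y)

initialRun : List ℕ → ℕ
initialRun []           = 0
initialRun (x ∷ [])     = 1
initialRun (x ∷ y ∷ ys) = if y <ᵇ x then suc (initialRun (y ∷ ys)) else 1

hasDecRun : ℕ → List ℕ → Bool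
hasDecRun k []       = false
hasDecRun k (x ∷ xs) = (k ≤ᵇ initialRun (x ∷ xs)) ∨ hasDecRun k xs

decreasingWindow : ∀ k t →
  ((length (take (suc k) t) ≡ᵇ suc k) ∧ strictlyDecreasing (take (suc k) t)) ≡ (suc k ≤ᵇ initialRun t)
decreasingWindow k       []           = refl
decreasingWindow zero    (x ∷ [])     = refl
decreasingWindow (suc k) (x ∷ [])     = refl
decreasingWindow zero    (x ∷ y ∷ ys) with y <ᵇ x
... | true  = refl
... | false = refl
decreasingWindow (suc k) (x ∷ y ∷ ys) with y <ᵇ x
... | true  = decreasingWindow k (y ∷ ys)
... | false = ∧-zeroʳ _

containsDecRun≡hasDecRun : ∀ k π → containsDecRun (suc k) π ≡ hasDecRun (suc k) π
containsDecRun≡hasDecRun k []       = refl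
containsDecRun≡hasDecRun k (x ∷ xs) = cong₂ _∨_ (decreasingWindow k (x ∷ xs)) (containsDecRun≡hasDecRun k xs)

Preserves<ᵇ : (ℕ → ℕ) → Set
Preserves<ᵇ g = ∀ x y → (g x <ᵇ g y) ≡ (x <ᵇ y)

+-preserves<ᵇ : ∀ c → Preserves<ᵇ (c +_)
+-preserves<ᵇ zero    x y = refl
+-preserves<ᵇ (suc c) x y = +-preserves<ᵇ c x y

module _ {g : ℕ → ℕ} (g-preserves : Preserves<ᵇ g) where

  initialRun-map : ∀ xs → initialRun (map g xs) ≡ initialRun xs
  initialRun-map []           = refl
  initialRun-map (x ∷ [])     = refl
  initialRun-map (x ∷ y ∷ ys) with ih ← initialRun-map (y ∷ ys) rewrite g-preserves y x | ih = refl

  hasDecRun-map : ∀ k xs → hasDecRun k (map g xs) ≡ hasDecRun k xs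
  hasDecRun-map k []       = refl
  hasDecRun-map k (x ∷ xs) rewrite initialRun-map (x ∷ xs) | hasDecRun-map k xs = refl

  has32above-map : ∀ a ys → has32above (g a) (map g ys) ≡ has32above a ys
  has32above-map a []       = refl
  has32above-map a (b ∷ ys)
    rewrite g-preserves a b | has32above-map a ys
          | any-map (λ z → (g a <ᵇ z) ∧ (z <ᵇ g b)) g ys
          | any-cong {q = λ z → (a <ᵇ z) ∧ (z <ᵇ b)} ys (λ z → cong₂ _∧_ (g-preserves a z) (g-preserves z b)) = refl

  contains132-map : ∀ xs → contains132 (map g xs) ≡ contains132 xs
  contains132-map []       = refl
  contains132-map (x ∷ xs) rewrite has32above-map x xs | contains132-map xs = refl

initialRun-++-max : ∀ m x xs ys → All (_< m) (x ∷ xs) → initialRun ((x ∷ xs) ++ m ∷ ys) ≡ initialRun (x ∷ xs)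
initialRun-++-max m x []        ys (x<m ∷ _) rewrite ≤⇒<ᵇ≡false (<⇒≤ x<m) = refl
initialRun-++-max m x (x′ ∷ xs) ys (_ ∷ xs<m) rewrite initialRun-++-max m x′ xs ys xs<m = refl

initialRun-max-∷ : ∀ m ys → All (_< m) ys → initialRun (m ∷ ys) ≡ suc (initialRun ys)
initialRun-max-∷ m []       _          = refl
initialRun-max-∷ m (y ∷ ys) (y<m ∷ _) rewrite <⇒<ᵇ≡true y<m = refl

hasDecRun-++-max : ∀ k m xs ys → All (_< m) xs → hasDecRun k (xs ++ m ∷ ys) ≡ hasDecRun k xs ∨ hasDecRun k (m ∷ ys)
hasDecRun-++-max k m []       ys _ = refl
hasDecRun-++-max k m (x ∷ xs) ys xs<m@(_ ∷ xs<m′)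
  rewrite initialRun-++-max m x xs ys xs<m | hasDecRun-++-max k m xs ys xs<m′ =
  sym (∨-assoc (k ≤ᵇ initialRun (x ∷ xs)) _ _)

has32above-below : ∀ a ys → All (_≤ a) ys → has32above a ys ≡ false
has32above-below a []       _            = refl
has32above-below a (b ∷ ys) (b≤a ∷ ys≤a) rewrite ≤⇒<ᵇ≡false b≤a = has32above-below a ys ys≤a

below-not-between : ∀ x b {ys} → All (_< x) ys → All (λ c → ((x <ᵇ c) ∧ (c <ᵇ b)) ≡ false) ys
below-not-between x b = All.map (λ {c} c<x → cong (_∧ (c <ᵇ b)) (≤⇒<ᵇ≡false (<⇒≤ c<x)))

has32above-++-max : ∀ x m xs ys → x < m → All (_< m) xs → All (_< x) ys →
  has32above x (xs ++ m ∷ ys) ≡ has32above x xs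
has32above-++-max x m []       ys x<m _ ys<x
  rewrite any-false _ ys (below-not-between x m ys<x) | has32above-below x ys (All.map <⇒≤ ys<x) | <⇒<ᵇ≡true x<m = refl
has32above-++-max x m (b ∷ xs) ys x<m (b<m ∷ xs<m) ys<x
  rewrite any-++ (λ c → (x <ᵇ c) ∧ (c <ᵇ b)) xs (m ∷ ys) | ≤⇒<ᵇ≡false (<⇒≤ b<m) | ∧-zeroʳ (x <ᵇ m)
        | any-false _ ys (below-not-between x b ys<x) | ∨-identityʳ (any (λ c → (x <ᵇ c) ∧ (c <ᵇ b)) xs)
        | has32above-++-max x m xs ys x<m xs<m ys<x = refl

contains132-++-max : ∀ m xs ys → All (_< m) xs → All (_< m) ys → All (λ x → All (_< x) ys) xs →
  contains132 (xs ++ m ∷ ys) ≡ contains132 xs ∨ contains132 ys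
contains132-++-max m []       ys _ ys<m _ rewrite has32above-below m ys (All.map <⇒≤ ys<m) = refl
contains132-++-max m (x ∷ xs) ys (x<m ∷ xs<m) ys<m (ys<x ∷ ys<xs)
  rewrite has32above-++-max x m xs ys x<m xs<m ys<x | contains132-++-max m xs ys xs<m ys<m ys<xs =
  sym (∨-assoc (has32above x xs) _ _)

contains132-witness : ∀ a b m xs ys → a ∈ xs → b ∈ ys → a < b → b < m → contains132 (xs ++ m ∷ ys) ≡ true
contains132-witness a b m (x ∷ xs) ys (here refl) b∈ a<b b<m = cong (_∨ _) (witness-after xs)
  where
  witness-after : ∀ zs → has32above a (zs ++ m ∷ ys) ≡ true
  witness-after []
    rewrite <⇒<ᵇ≡true (<-trans a<b b<m)
          | any-true (λ c → (a <ᵇ c) ∧ (c <ᵇ m)) ys b∈ (cong₂ _∧_ (<⇒<ᵇ≡true a<b) (<⇒<ᵇ≡true b<m)) = refl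
  witness-after (z ∷ zs) rewrite witness-after zs = ∨-zeroʳ _
contains132-witness a b m (x ∷ xs) ys (there a∈) b∈ a<b b<m
  rewrite contains132-witness a b m xs ys a∈ b∈ a<b b<m = ∨-zeroʳ _

-- Decomposition of a 1-3-2 avoider at its maximum

-- The permutation of [n+1] with its maximum at position i, preceded by the values n−i+1, …, n
-- in the pattern a and followed by 1, …, n−i in the pattern b.
placeMax : ℕ → ℕ → List ℕ → List ℕ → List ℕ
placeMax n i a b = map (n ∸ i +_) a ++ suc n ∷ b

maxAt : ℕ → ℕ → List (List ℕ)
maxAt n i = concatMap (λ a → map (placeMax n i a) (perms (n ∸ i))) (perms i)

decomposed : ℕ → List (List ℕ)
decomposed n = concatMap (maxAt n) (upTo (suc n))

placeMax-bounds : ∀ n i a b → i ≤ n → a ∈ perms i → b ∈ perms (n ∸ i) →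
  All (_< suc n) (map (n ∸ i +_) a) × All (_< suc n) b × All (λ y → All (_< y) b) (map (n ∸ i +_) a)
placeMax-bounds n i a b i≤n a∈ b∈ = All-map⁺ (All.tabulate a<) , All.tabulate b< , All-map⁺ (All.tabulate b<a)
  where
  c : ℕ
  c = n ∸ i
  a< : ∀ {z} → z ∈ a → c + z < suc n
  a< z∈ = s≤s (subst (c + _ ≤_) (m∸n+n≡m i≤n) (+-monoʳ-≤ c (proj₂ (perms-bounds i a∈ z∈))))
  b< : ∀ {w} → w ∈ b → w < suc n
  b< w∈ = s≤s (≤-trans (proj₂ (perms-bounds c b∈ w∈)) (m∸n≤m n i))
  b<a : ∀ {z} → z ∈ a → All (_< c + z) b
  b<a {z} z∈ = All.tabulate (λ w∈ → ≤-trans (s≤s (proj₂ (perms-bounds c b∈ w∈)))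
                                            (subst (_≤ c + z) (+-comm c 1) (+-monoʳ-≤ c (proj₁ (perms-bounds i a∈ z∈)))))

indexOf : ℕ → List ℕ → ℕ
indexOf x []       = 0
indexOf x (y ∷ ys) with y ≟ x
... | yes _ = 0
... | no  _ = suc (indexOf x ys)

indexOf-++ : ∀ x xs ys → x ∉ xs → indexOf x (xs ++ x ∷ ys) ≡ length xs
indexOf-++ x []       ys _ with x ≟ x
... | yes _   = refl
... | no  x≢x = ⊥-elim (x≢x refl)
indexOf-++ x (y ∷ xs) ys x∉ with y ≟ x
... | yes refl = ⊥-elim (x∉ (here refl))
... | no  _    = cong suc (indexOf-++ x xs ys (λ x∈ → x∉ (there x∈)))

take-length-++ : ∀ (xs ys : List A) → take (length xs) (xs ++ ys) ≡ xs
take-length-++ []       ys = refl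
take-length-++ (x ∷ xs) ys = cong (x ∷_) (take-length-++ xs ys)

map-∸-+ : ∀ c xs → map (_∸ c) (map (c +_) xs) ≡ xs
map-∸-+ c xs = trans (sym (map-∘ xs)) (map-id-local (All.tabulate (λ {x} _ → m+n∸m≡n c x)))

decomposed-unique : ∀ n → Unique (decomposed n)
decomposed-unique n =
  concatMap-unique (maxAt n) (indexOf (suc n)) (Unique.upTo⁺ (suc n)) (λ i _ → maxAt-unique i) index-decodes
  where
  open ≡-Reasoning
  index-decodes : ∀ i π → i ∈ upTo (suc n) → π ∈ maxAt n i → indexOf (suc n) π ≡ i
  index-decodes i π i∈ π∈
    with a , a∈ , π∈row ← find (∈-concatMap⁻ _ {xs = perms i} π∈)
    with b , b∈ , refl ← ∈-map⁻ (placeMax n i a) π∈row =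
    trans (indexOf-++ (suc n) (map (n ∸ i +_) a) b n+1∉) (trans (length-map _ a) (perms-length i a∈))
    where
    n+1∉ : suc n ∉ map (n ∸ i +_) a
    n+1∉ n+1∈ = <-irrefl refl (All.lookup (proj₁ (placeMax-bounds n i a b (≤-pred (∈-upTo⁻ i∈)) a∈ b∈)) n+1∈)

  maxAt-unique : ∀ i → Unique (maxAt n i)
  maxAt-unique i =
    concatMap-unique (λ a → map (placeMax n i a) (perms (n ∸ i))) (λ π → map (_∸ (n ∸ i)) (take i π)) (perms-unique i)
      (λ a _ → Unique.map⁺ (λ eq → ∷-injectiveʳ (++-cancelˡ (map (n ∸ i +_) a) _ _ eq)) (perms-unique (n ∸ i)))
      prefix-decodes
    where
    prefix-decodes : ∀ a π → a ∈ perms i → π ∈ map (placeMax n i a) (perms (n ∸ i)) →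
      map (_∸ (n ∸ i)) (take i π) ≡ a
    prefix-decodes a π a∈ π∈ with b , _ , refl ← ∈-map⁻ (placeMax n i a) π∈ = begin
      map (_∸ (n ∸ i)) (take i (a′ ++ suc n ∷ b))           ≡⟨ cong (λ l → map (_∸ (n ∸ i)) (take l (a′ ++ suc n ∷ b))) length-a′ ⟨
      map (_∸ (n ∸ i)) (take (length a′) (a′ ++ suc n ∷ b)) ≡⟨ cong (map (_∸ (n ∸ i))) (take-length-++ a′ _) ⟩
      map (_∸ (n ∸ i)) a′                                   ≡⟨ map-∸-+ (n ∸ i) a ⟩
      a                                                     ∎
      where
      a′ : List ℕ
      a′ = map (n ∸ i +_) a
      length-a′ : length a′ ≡ i
      length-a′ = trans (length-map _ a) (perms-length i a∈)

placeMax-↭ : ∀ n i {a b} → i ≤ n → a ↭ interval 0 i → b ↭ interval 0 (n ∸ i) → placeMax n i a b ↭ interval 0 (suc n)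
placeMax-↭ n i {a} {b} i≤n a↭ b↭ = begin
  map (c +_) a ++ suc n ∷ b                   ↭⟨ ↭-++⁺ (↭-map⁺ (c +_) a↭) (↭-prep (suc n) b↭) ⟩
  map (c +_) (interval 0 i) ++ suc n ∷ interval 0 c ≡⟨ cong (_++ suc n ∷ interval 0 c) (map-+-interval c i) ⟩
  interval c i ++ suc n ∷ interval 0 c        ↭⟨ ↭-++-comm (interval c i) (suc n ∷ interval 0 c) ⟩
  suc n ∷ interval 0 c ++ interval c i        ↭⟨ ∷↭∷ʳ (suc n) (interval 0 c ++ interval c i) ⟩
  (interval 0 c ++ interval c i) ++ [ suc n ] ≡⟨ cong (_++ [ suc n ]) (interval-++ 0 c i) ⟨
  interval 0 (c + i) ++ [ suc n ]             ≡⟨ cong (λ m → interval 0 m ++ [ suc n ]) (m∸n+n≡m i≤n) ⟩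
  interval 0 n ++ [ suc n ]                   ≡⟨ interval-∷ʳ n ⟨
  interval 0 (suc n)                          ∎
  where
  open PermutationReasoning
  c : ℕ
  c = n ∸ i

decomposed⊆perms : ∀ n {π} → π ∈ decomposed n → π ∈ perms (suc n)
decomposed⊆perms n π∈
  with i , i∈ , π∈maxAt ← find (∈-concatMap⁻ (maxAt n) {xs = upTo (suc n)} π∈)
  with a , a∈ , π∈row ← find (∈-concatMap⁻ _ {xs = perms i} π∈maxAt)
  with b , b∈ , refl ← ∈-map⁻ (placeMax n i a) π∈row =
  ↭-perms (suc n) (placeMax-↭ n i (≤-pred (∈-upTo⁻ i∈)) (perms-↭ i a∈) (perms-↭ (n ∸ i) b∈))

module _ {P : ℕ → Set} (P? : Decidable P) where

  filter-keepsˡ : ∀ {xs ys} → All P xs → All (∁ P) ys → filter P? (xs ++ ys) ≡ xs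
  filter-keepsˡ {xs} {ys} pxs ¬pys =
    trans (filter-++ P? xs ys) (trans (cong₂ _++_ (filter-all P? pxs) (filter-none P? ¬pys)) (++-identityʳ xs))

  filter-keepsʳ : ∀ {xs ys} → All (∁ P) xs → All P ys → filter P? (xs ++ ys) ≡ ys
  filter-keepsʳ {xs} {ys} ¬pxs pys = trans (filter-++ P? xs ys) (cong₂ _++_ (filter-none P? ¬pxs) (filter-all P? pys))

↭-interval-split : ∀ n c {xs ys} → c ≤ n → xs ++ ys ↭ interval 0 n → All (c <_) xs → All (_≤ c) ys →
  xs ↭ interval c (n ∸ c) × ys ↭ interval 0 c
↭-interval-split n c {xs} {ys} c≤n xs++ys↭ c<xs ys≤c = upper , lower
  where
  open PermutationReasoning
  split : interval 0 n ≡ interval 0 c ++ interval c (n ∸ c)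
  split = trans (cong (interval 0) (sym (m+[n∸m]≡n c≤n))) (interval-++ 0 c (n ∸ c))
  lower-bounded : All (_≤ c) (interval 0 c)
  lower-bounded = All.tabulate (λ z∈ → proj₂ (interval-bounds 0 c z∈))
  upper-bounded : All (c <_) (interval c (n ∸ c))
  upper-bounded = All.tabulate (λ z∈ → proj₁ (interval-bounds c (n ∸ c) z∈))
  upper : xs ↭ interval c (n ∸ c)
  upper = begin
    xs                                                  ≡⟨ filter-keepsˡ (c <?_) c<xs (All.map ≤⇒≯ ys≤c) ⟨
    filter (c <?_) (xs ++ ys)                           ↭⟨ filter-↭ (c <?_) xs++ys↭ ⟩
    filter (c <?_) (interval 0 n)                       ≡⟨ cong (filter (c <?_)) split ⟩
    filter (c <?_) (interval 0 c ++ interval c (n ∸ c)) ≡⟨ filter-keepsʳ (c <?_) (All.map ≤⇒≯ lower-bounded) upper-bounded ⟩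
    interval c (n ∸ c)                                  ∎
  lower : ys ↭ interval 0 c
  lower = begin
    ys                                                  ≡⟨ filter-keepsʳ (_≤? c) (All.map <⇒≱ c<xs) ys≤c ⟨
    filter (_≤? c) (xs ++ ys)                           ↭⟨ filter-↭ (_≤? c) xs++ys↭ ⟩
    filter (_≤? c) (interval 0 n)                       ≡⟨ cong (filter (_≤? c)) split ⟩
    filter (_≤? c) (interval 0 c ++ interval c (n ∸ c)) ≡⟨ filter-keepsˡ (_≤? c) lower-bounded (All.map <⇒≱ upper-bounded) ⟩
    interval 0 c                                        ∎

unique-++⇒≢ : ∀ (xs ys : List A) {x y} → Unique (xs ++ ys) → x ∈ xs → y ∈ ys → x ≢ y
unique-++⇒≢ (x ∷ xs) ys (x∉ ∷ _) (here refl) y∈ = All.lookup x∉ (∈-++⁺ʳ xs y∈)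
unique-++⇒≢ (x ∷ xs) ys (_ ∷ u)  (there x∈)  y∈ = unique-++⇒≢ xs ys u x∈ y∈

-- The maximum n+1 of a 1-3-2 avoider splits it into a block of large values followed by a block
-- of small values; the threshold between them is the largest value after n+1.
avoider∈decomposed : ∀ n {π} → π ∈ perms (suc n) → contains132 π ≡ false → π ∈ decomposed n
avoider∈decomposed n {π} π∈ avoids
  with α , β , refl ← ∈-∃++ (∈-resp-↭ (↭-sym (perms-↭ (suc n) π∈)) (last∈interval n)) =
  ∈-concatMap⁺ (maxAt n) (lose (∈-upTo⁺ (s≤s (m∸n≤m n c)))
    (∈-concatMap⁺ _ (lose (↭-perms i a↭) (subst (_∈ map (placeMax n i a) (perms (n ∸ i))) placeMax≡ (∈-map⁺ _ β∈)))))
  where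
  open ≡-Reasoning
  α++β↭ : α ++ β ↭ interval 0 n
  α++β↭ = ↭-trans (drop-mid α (interval 0 n) (↭-trans (perms-↭ (suc n) π∈) (↭-reflexive (interval-∷ʳ n))))
                  (↭-reflexive (++-identityʳ (interval 0 n)))
  bounded : ∀ {z} → z ∈ α ++ β → 0 < z × z ≤ n
  bounded z∈ = interval-bounds 0 n (∈-resp-↭ α++β↭ z∈)
  β<α : ∀ {a} → a ∈ α → All (_< a) β
  β<α {a} a∈ = All.tabulate λ b∈ → ≤∧≢⇒< (≮⇒≥ (a≮b b∈)) (λ b≡a → a≢b b∈ (sym b≡a))
    where
    a≢b : ∀ {b} → b ∈ β → a ≢ b
    a≢b = unique-++⇒≢ α β (unique-resp-↭ (↭-sym α++β↭) (interval-unique 0 n)) a∈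
    a≮b : ∀ {b} → b ∈ β → ¬ a < b
    a≮b {b} b∈ a<b
      with () ← trans (sym (contains132-witness a b (suc n) α β a∈ b∈ a<b (s≤s (proj₂ (bounded (∈-++⁺ʳ α b∈)))))) avoids
  c : ℕ
  c = max 0 β
  i : ℕ
  i = n ∸ c
  c≤n : c ≤ n
  c≤n = max≤v⁺ z≤n (All.tabulate (λ b∈ → proj₂ (bounded (∈-++⁺ʳ α b∈))))
  c<α : All (c <_) α
  c<α = All.tabulate (λ a∈ → max<v⁺ (proj₁ (bounded (∈-++⁺ˡ a∈))) (β<α a∈))
  split : α ↭ interval c (n ∸ c) × β ↭ interval 0 c
  split = ↭-interval-split n c c≤n α++β↭ c<α (xs≤max 0 β)
  n∸i≡c : n ∸ i ≡ c
  n∸i≡c = m∸[m∸n]≡n c≤n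
  a : List ℕ
  a = map (_∸ c) α
  a↭ : a ↭ interval 0 i
  a↭ = ↭-trans (↭-map⁺ (_∸ c) (proj₁ split))
               (↭-reflexive (trans (cong (map (_∸ c)) (sym (map-+-interval c i))) (map-∸-+ c (interval 0 i))))
  β∈ : β ∈ perms (n ∸ i)
  β∈ = subst (λ d → β ∈ perms d) (sym n∸i≡c) (↭-perms c (proj₂ split))
  placeMax≡ : placeMax n i a β ≡ α ++ suc n ∷ β
  placeMax≡ = cong (_++ suc n ∷ β) (begin
    map (n ∸ i +_) a   ≡⟨ cong (λ d → map (d +_) a) n∸i≡c ⟩
    map (c +_) a       ≡⟨ map-∘ α ⟨
    map (λ z → c + (z ∸ c)) α ≡⟨ map-id-local (All.map (λ c<z → m+[n∸m]≡n (<⇒≤ c<z)) c<α) ⟩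
    α                  ∎)

-- Counting by the length of the initial run

not-∨ : ∀ a b → not (a ∨ b) ≡ not a ∧ not b
not-∨ true  b = refl
not-∨ false b = refl

admissible : ℕ → ℕ → List ℕ → Bool
admissible k e π = avoids132and k π ∧ (initialRun π <ᵇ e)

countAdmissible : ℕ → ℕ → Series
countAdmissible k e n = countᵇ (admissible k e) (perms n)

not-∨-guarded : ∀ c d y {x} → (y ≡ true → x ≡ false) → (not c ∧ not (x ∨ d)) ∧ y ≡ (not c ∧ not d) ∧ y
not-∨-guarded c d false _    = trans (∧-zeroʳ _) (sym (∧-zeroʳ _))
not-∨-guarded c d true  y⇒¬x rewrite y⇒¬x refl = refl

not-∨-regroup : ∀ cX cY dX dY x y →
  (not (cX ∨ cY) ∧ not (dX ∨ (not y ∨ dY))) ∧ x ≡ ((not cX ∧ not dX) ∧ x) ∧ ((not cY ∧ not dY) ∧ y)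
not-∨-regroup cX cY dX dY x y = begin
  (not (cX ∨ cY) ∧ not (dX ∨ (not y ∨ dY))) ∧ x
    ≡⟨ cong₂ (λ u v → (u ∧ v) ∧ x) (not-∨ cX cY) (trans (not-∨ dX _) (cong (not dX ∧_) (not-∨ (not y) dY))) ⟩
  ((not cX ∧ not cY) ∧ (not dX ∧ (not (not y) ∧ not dY))) ∧ x
    ≡⟨ cong (λ u → ((not cX ∧ not cY) ∧ (not dX ∧ (u ∧ not dY))) ∧ x) (not-involutive y) ⟩
  ((not cX ∧ not cY) ∧ (not dX ∧ (y ∧ not dY))) ∧ x
    ≡⟨ regroup (not cX) (not cY) (not dX) (not dY) x y ⟩
  ((not cX ∧ not dX) ∧ x) ∧ ((not cY ∧ not dY) ∧ y) ∎
  where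
  open ≡-Reasoning
  regroup : ∀ a b c d x y → ((a ∧ b) ∧ (c ∧ (y ∧ d))) ∧ x ≡ ((a ∧ c) ∧ x) ∧ ((b ∧ d) ∧ y)
  regroup = solve 6 (λ a b c d x y → ((a ∙ b) ∙ (c ∙ (y ∙ d))) ∙ x ⊜ ((a ∙ c) ∙ x) ∙ ((b ∙ d) ∙ y)) refl

module _ (k′ : ℕ) where

  private
    k : ℕ
    k = suc k′

  admissible-map : ∀ {g} → Preserves<ᵇ g → ∀ e xs → admissible k e (map g xs) ≡ admissible k e xs
  admissible-map {g} g-preserves e xs
    rewrite containsDecRun≡hasDecRun k′ (map g xs) | containsDecRun≡hasDecRun k′ xs
          | contains132-map {g} g-preserves xs | hasDecRun-map {g} g-preserves k xs | initialRun-map {g} g-preserves xs = refl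

  admissible-max-∷ : ∀ e m ys → e ≤ k′ → All (_< m) ys → admissible k (suc e) (m ∷ ys) ≡ admissible k e ys
  admissible-max-∷ e m ys e≤k′ ys<m
    rewrite containsDecRun≡hasDecRun k′ (m ∷ ys) | containsDecRun≡hasDecRun k′ ys
          | has32above-below m ys (All.map <⇒≤ ys<m) | initialRun-max-∷ m ys ys<m =
    not-∨-guarded (contains132 ys) (hasDecRun k ys) (initialRun ys <ᵇ e) long-run-excluded
    where
    long-run-excluded : (initialRun ys <ᵇ e) ≡ true → (k′ <ᵇ suc (initialRun ys)) ≡ false
    long-run-excluded r<e = ≤⇒<ᵇ≡false (≤-trans (<ᵇ≡true⇒< r<e) e≤k′)

  admissible-++-max : ∀ e m x xs ys → All (_< m) (x ∷ xs) → All (_< m) ys → All (λ z → All (_< z) ys) (x ∷ xs) →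
    admissible k e ((x ∷ xs) ++ m ∷ ys) ≡ admissible k e (x ∷ xs) ∧ admissible k k′ ys
  admissible-++-max e m x xs ys xs<m ys<m ys<xs
    rewrite containsDecRun≡hasDecRun k′ ((x ∷ xs) ++ m ∷ ys)
          | containsDecRun≡hasDecRun k′ (x ∷ xs) | containsDecRun≡hasDecRun k′ ys
          | contains132-++-max m (x ∷ xs) ys xs<m ys<m ys<xs
          | hasDecRun-++-max k m (x ∷ xs) ys xs<m
          | initialRun-++-max m x xs ys xs<m | initialRun-max-∷ m ys ys<m | <ᵇ-suc k′ (initialRun ys) =
    not-∨-regroup (contains132 (x ∷ xs)) (contains132 ys) (hasDecRun k (x ∷ xs)) (hasDecRun k ys) _ _

  initialRun-short : ∀ π → hasDecRun k π ≡ false → (initialRun π <ᵇ k) ≡ true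
  initialRun-short []       _      = refl
  initialRun-short (x ∷ xs) no-run with k′ <ᵇ initialRun (x ∷ xs) in long
  ... | false = trans (<ᵇ-suc (initialRun (x ∷ xs)) k′) (cong not long)
  ... | true  with () ← no-run

  admissible-top : ∀ π → admissible k k π ≡ avoids132and k π
  admissible-top π rewrite containsDecRun≡hasDecRun k′ π with hasDecRun k π in no-run
  ... | true  rewrite ∧-zeroʳ (not (contains132 π)) = refl
  ... | false rewrite initialRun-short π no-run = ∧-identityʳ _

  countAdmissible-zero : ∀ n → countAdmissible k 0 n ≡ 0
  countAdmissible-zero n = trans (countᵇ-cong (perms n) (λ π _ → ∧-zeroʳ (avoids132and k π))) (countᵇ-false (perms n))

  countAdmissible-top : ∀ n → countAdmissible k k n ≡ f k n
  countAdmissible-top n = countᵇ-cong (perms n) (λ π _ → admissible-top π)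

  countAdmissible-maxAt : ∀ e → e ≤ k′ → ∀ n i → i ≤ n →
    countᵇ (admissible k (suc e)) (maxAt n i)
      ≡ oneS i * countAdmissible k e (n ∸ i) + positivePart (countAdmissible k (suc e)) i * countAdmissible k k′ (n ∸ i)
  countAdmissible-maxAt e e≤k′ n zero _ =
    trans (countᵇ-product (admissible k (suc e)) (λ _ → true) (admissible k e) (placeMax n 0) (perms 0) (perms n)
                          max-first)
          (sym (+-identityʳ _))
    where
    max-first : ∀ a b → a ∈ perms 0 → b ∈ perms n → admissible k (suc e) (placeMax n 0 a b) ≡ true ∧ admissible k e b
    max-first .[] b (here refl) b∈ =
      admissible-max-∷ e (suc n) b e≤k′ (proj₁ (proj₂ (placeMax-bounds n 0 [] b z≤n (here refl) b∈)))
  countAdmissible-maxAt e e≤k′ n (suc i) i<n =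
    countᵇ-product (admissible k (suc e)) (admissible k (suc e)) (admissible k k′) (placeMax n (suc i))
                   (perms (suc i)) (perms (n ∸ suc i)) max-inside
    where
    max-inside : ∀ a b → a ∈ perms (suc i) → b ∈ perms (n ∸ suc i) →
      admissible k (suc e) (placeMax n (suc i) a b) ≡ admissible k (suc e) a ∧ admissible k k′ b
    max-inside []      b a∈ b∈ with () ← perms-length (suc i) a∈
    max-inside (x ∷ a) b a∈ b∈ with a<m , b<m , b<a ← placeMax-bounds n (suc i) (x ∷ a) b i<n a∈ b∈ =
      trans (admissible-++-max (suc e) (suc n) (n ∸ suc i + x) (map (n ∸ suc i +_) a) b a<m b<m b<a)
            (cong (_∧ admissible k k′ b) (admissible-map (+-preserves<ᵇ (n ∸ suc i)) (suc e) (x ∷ a)))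

  countAdmissible-suc : ∀ e → e ≤ k′ → ∀ n →
    countAdmissible k (suc e) (suc n) ≡ countAdmissible k e n + (positivePart (countAdmissible k (suc e)) ⊗ countAdmissible k k′) n
  countAdmissible-suc e e≤k′ n = begin
    countᵇ p (perms (suc n))
      ≡⟨ countᵇ-unique p (perms-unique (suc n)) (decomposed-unique n)
           (λ π pπ π∈ → avoider∈decomposed n π∈ (admissible⇒avoids132 π pπ)) (λ π _ π∈ → decomposed⊆perms n π∈) ⟩
    countᵇ p (decomposed n)
      ≡⟨ countᵇ-concatMap-upTo p (maxAt n) n ⟩
    sumTo n (λ i → countᵇ p (maxAt n i))
      ≡⟨ sumTo-cong n (countAdmissible-maxAt e e≤k′ n) ⟩
    sumTo n (λ i → oneS i * N e (n ∸ i) + positivePart (N (suc e)) i * N k′ (n ∸ i))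
      ≡⟨ sumTo-+ n _ _ ⟩
    (oneS ⊗ N e) n + (positivePart (N (suc e)) ⊗ N k′) n
      ≡⟨ cong (_+ (positivePart (N (suc e)) ⊗ N k′) n) (⊗-identityˡ (N e) n) ⟩
    N e n + (positivePart (N (suc e)) ⊗ N k′) n ∎
    where
    open ≡-Reasoning
    N : ℕ → Series
    N = countAdmissible k
    p : List ℕ → Bool
    p = admissible k (suc e)
    admissible⇒avoids132 : ∀ π → p π ≡ true → contains132 π ≡ false
    admissible⇒avoids132 π pπ with contains132 π
    ... | false = refl
    ... | true  with () ← pπ

theorem2p12 : (k : ℕ) → 1 ≤ k → (n : ℕ) →
    F k n ≡ sumSeries k (λ j → xTimes (F k) ^S j) n
theorem2p12 (suc k′) _ =
  RecurrenceSolution.functionalEquation k′ (F (suc k′)) (countAdmissible (suc k′))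
    (countAdmissible-zero k′) (λ _ → refl) (countAdmissible-suc k′) (countAdmissible-top k′)
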